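{- Let $H$ be a small $\tau$-subgraph${}^+$ with $R(H) \leq r$, and let $H'$ be a small $\tau$-subgraph with at most $s$ leaf variables that are not in $H$, where $r+s \leq \zeta \cdot \mathrm{SMALL}$. Suppose also that $H'$ has $b$ edges that are ``boundary'' for $H$, in the sense that each has exactly one endpoint in $H$. Then $R(H \cup H') \leq r + s - b$.
   Context: Setting: $G$ is a bipartite factor graph with $n$ variable-vertices and $m$ constraint-vertices; each constraint-vertex $f$ has an ordered neighborhood $N(f)$ of variable-vertices with $\tau-1 \leq |N(f)| \leq K$, where $3 \leq \tau \leq K$ are integers. Parameters $1 \leq \mathrm{SMALL} \leq n/2$ and $0<\zeta<1$ satisfy $K \leq \zeta\cdot \mathrm{SMALL}$. A subgraph of $G$ means an edge-induced subgraph (possibly empty, not necessarily connected). A subgraph is small if it has at most $\mathrm{SMALL}$ constraint-vertices. A $\tau$-subgraph is a subgraph in which every constraint-vertex has degree at least $\tau$ within the subgraph; a $\tau$-subgraph${}^+$ is a $\tau$-subgraph together with zero or more isolated variable-vertices. A variable-vertex of degree 1 in $H$ is a leaf. Accounting (each edge viewed as two directed edges): each leaf variable-vertex gets one credit, each isolated variable-vertex two credits; each variable-vertex gets one debit per out-edge beyond 2, each constraint-vertex one debit per out-edge beyond $\tau$. Revenue $R(H)$ = credits minus debits; cost $C(H)=\zeta\cdot(\#\text{constraint-vertices})$; income $I(H)=R(H)-C(H)$; plausible means $I(H)\ge 0$. Plausibility Assumption on $G$: every $\tau$-subgraph with at most $2\cdot\mathrm{SMALL}$ constraint-vertices is plausible.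 (Under these hypotheses one already knows $H\cup H'$ is small and $R(H\cup H')\le r+s$.)
   Formalization: The parameter ζ and the bounds r and s take values in ℚ. -}

module Defs where

open import Data.Nat as ℕ using (ℕ; zero; suc; _∸_; _≤_)
open import Data.Integer as ℤ using (ℤ; +_)
open import Data.Rational as ℚ using (ℚ)
open import Data.Fin using (Fin; zero; suc)
open import Data.Fin.Properties using () renaming (_≟_ to _≟F_)
open import Data.Bool using (Bool; true; false; _∧_; _∨_; _xor_; not; if_then_else_)
open import Relation.Nullary.Decidable using (⌊_⌋)
open import Relation.Binary.PropositionalEquality using (_≡_)
open import Data.Product using (_×_)

sumFin : (k : ℕ) → (Fin k → ℕ) → ℕ
sumFin zero    g = 0
sumFin (suc k) g = g zero ℕ.+ sumFin k (λ i → g (suc i))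

count : (k : ℕ) → (Fin k → Bool) → ℕ
count k p = sumFin k (λ i → if p i then 1 else 0)

ℕ→ℚ : ℕ → ℚ
ℕ→ℚ k = + k ℚ./ 1

ℤ→ℚ : ℤ → ℚ
ℤ→ℚ z = z ℚ./ 1

isPos : ℕ → Bool
isPos zero    = false
isPos (suc _) = true

isOne : ℕ → Bool
isOne (suc zero) = true
isOne _          = false

-- Bipartite factor graph: n variable-vertices, m constraint-vertices,
-- constraint f has ordered neighbourhood  nb f 0 , … , nb f (arity f - 1).
-- An edge of G is a pair (f , i) with i : Fin (arity f) (position in N(f)).

record FactorGraph : Set where
  field
    n     : ℕ
    m     : ℕ
    arity : Fin m → ℕ
    nb    : (f : Fin m) → Fin (arity f) → Fin n
open FactorGraph public

-- A subgraph (possibly with extra, isolated variable-vertices):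
-- an edge set plus a set of extra variable-vertices.
record Subgraph (G : FactorGraph) : Set where
  field
    edge  : (f : Fin (m G)) → Fin (arity G f) → Bool
    extra : Fin (n G) → Bool
open Subgraph public

module _ {G : FactorGraph} where

  degC : Subgraph G → Fin (m G) → ℕ
  degC H f = count (arity G f) (edge H f)

  degV : Subgraph G → Fin (n G) → ℕ
  degV H v = sumFin (m G) (λ f → count (arity G f)
               (λ i → edge H f i ∧ ⌊ nb G f i ≟F v ⌋))

  inC : Subgraph G → Fin (m G) → Bool
  inC H f = isPos (degC H f)

  inV : Subgraph G → Fin (n G) → Bool
  inV H v = extra H v ∨ isPos (degV H v)

  numC : Subgraph G → ℕ
  numC H = count (m G) (inC H)

  isLeaf : Subgraph G → Fin (n G) → Bool
  isLeaf H v = isOne (degV H v)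

  isIsolated : Subgraph G → Fin (n G) → Bool
  isIsolated H v = inV H v ∧ not (isPos (degV H v))

  _∪_ : Subgraph G → Subgraph G → Subgraph G
  H ∪ H' = record { edge  = λ f i → edge H f i ∨ edge H' f i
                  ; extra = λ v → extra H v ∨ extra H' v }

  EdgeInduced : Subgraph G → Set
  EdgeInduced H = ∀ v → extra H v ≡ false

  TauCond : ℕ → Subgraph G → Set
  TauCond τ H = ∀ f → 1 ≤ degC H f → τ ≤ degC H f

  -- τ-subgraph⁺ : τ-subgraph together with zero or more isolated variables
  IsTauSubgraph⁺ : ℕ → Subgraph G → Set
  IsTauSubgraph⁺ τ H = TauCond τ H

  IsTauSubgraph : ℕ → Subgraph G → Set
  IsTauSubgraph τ H = EdgeInduced H × TauCond τ H

  Small : ℕ → Subgraph G → Set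
  Small SMALL H = numC H ≤ SMALL

  credits : Subgraph G → ℕ
  credits H = count (n G) (isLeaf H) ℕ.+ 2 ℕ.* count (n G) (isIsolated H)

  debits : ℕ → Subgraph G → ℕ
  debits τ H = sumFin (n G) (λ v → degV H v ∸ 2)
               ℕ.+ sumFin (m G) (λ f → degC H f ∸ τ)

  Revenue : ℕ → Subgraph G → ℤ
  Revenue τ H = + credits H ℤ.- + debits τ H

  Cost : ℚ → Subgraph G → ℚ
  Cost ζ H = ζ ℚ.* ℕ→ℚ (numC H)

  Income : ℕ → ℚ → Subgraph G → ℚ
  Income τ ζ H = ℤ→ℚ (Revenue τ H) ℚ.- Cost ζ H

  Plausible : ℕ → ℚ → Subgraph G → Set
  Plausible τ ζ H = ℚ.0ℚ ℚ.≤ Income τ ζ H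

  leavesOutside : Subgraph G → Subgraph G → ℕ
  leavesOutside H' H = count (n G) (λ v → isLeaf H' v ∧ not (inV H v))

  boundaryCount : Subgraph G → Subgraph G → ℕ
  boundaryCount H H' = sumFin (m G) (λ f → count (arity G f)
      (λ i → edge H' f i ∧ (inC H f xor inV H (nb G f i))))

PlausibilityAssumption : (τ SMALL : ℕ) (ζ : ℚ) (G : FactorGraph) → Set
PlausibilityAssumption τ SMALL ζ G =
  (H : Subgraph G) → IsTauSubgraph τ H → numC H ≤ 2 ℕ.* SMALL → Plausible τ ζ H

module Submission where

-- Split the edges of H ∪ H′ into those of H and the new ones (in H′ but not in H) and do the
-- accounting vertex by vertex.  Every new edge at a vertex already in H costs that vertex one
-- unit of revenue: a variable loses a leaf/isolated credit or gains a debit, and a constraint of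
-- H, having degree ≥ τ already, gains a debit.  A boundary edge is new (edges of H have both
-- ends in H) with exactly one end in H, so these losses add up to at least b.  A variable
-- outside H sees only edges of H′ and nets at most its leaf credit in H′, which is where s
-- comes from; constraints outside H only add debits.

open import Defs
open import Data.Nat as ℕ using (ℕ; _≤_; _∸_)
open import Data.Rational as ℚ using (ℚ)
open import Data.Fin using (Fin)
open import Relation.Binary.PropositionalEquality using (_≡_)

import Data.Nat.Properties as ℕP
import Data.Rational.Properties as ℚP
open import Algebra.Properties.Semiring.Sum ℕP.+-*-semiring
  using (sum; sum-cong-≗; ∑-distrib-+; ∑-comm; *-distribˡ-sum; sum-replicate-zero)
import Algebra.Properties.Group ℚP.+-0-group as ℚGroup
open import Data.Bool using (Bool; true; false; _∧_; _∨_; _xor_; not; if_then_else_)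
import Data.Bool.Properties as BP
open import Data.Fin using (zero; suc)
open import Data.Fin.Properties using () renaming (_≟_ to _≟F_)
import Data.Integer as ℤ
import Data.Integer.Properties as ℤP
import Data.Integer.Tactic.RingSolver as ℤSolver
open import Data.Nat using (zero; suc; _+_; _*_; z≤n; s≤s)
import Data.Nat.Coprimality as Coprime
open import Data.Nat.Tactic.RingSolver using (solve-∀)
open import Data.Product using (_×_; _,_)
open import Data.Rational using (mkℚ)
open import Relation.Binary.PropositionalEquality
  using (refl; cong; cong₂; sym; trans; subst; subst₂; module ≡-Reasoning)
open import Relation.Nullary.Decidable using (⌊_⌋; _because_; isYes≗does; dec-true)

⟦_⟧ : Bool → ℕ
⟦ b ⟧ = if b then 1 else 0

sumFin≡sum : ∀ k (g : Fin k → ℕ) → sumFin k g ≡ sum g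
sumFin≡sum zero    g = refl
sumFin≡sum (suc k) g = cong (g zero +_) (sumFin≡sum k (λ i → g (suc i)))

sumFin-cong : ∀ k {g h : Fin k → ℕ} → (∀ i → g i ≡ h i) → sumFin k g ≡ sumFin k h
sumFin-cong k {g} {h} g≗h rewrite sumFin≡sum k g | sumFin≡sum k h = sum-cong-≗ g≗h

sumFin-+ : ∀ k (g h : Fin k → ℕ) → sumFin k (λ i → g i + h i) ≡ sumFin k g + sumFin k h
sumFin-+ k g h rewrite sumFin≡sum k (λ i → g i + h i) | sumFin≡sum k g | sumFin≡sum k h =
  ∑-distrib-+ g h

sumFin-+₃ : ∀ k (f g h : Fin k → ℕ) →
  sumFin k (λ i → f i + g i + h i) ≡ sumFin k f + sumFin k g + sumFin k h
sumFin-+₃ k f g h = trans (sumFin-+ k _ h) (cong (_+ sumFin k h) (sumFin-+ k f g))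

sumFin-*ˡ : ∀ k c (g : Fin k → ℕ) → sumFin k (λ i → c * g i) ≡ c * sumFin k g
sumFin-*ˡ k c g rewrite sumFin≡sum k (λ i → c * g i) | sumFin≡sum k g = sym (*-distribˡ-sum c g)

sumFin-comm : ∀ a b (h : Fin a → Fin b → ℕ) →
  sumFin a (λ i → sumFin b (h i)) ≡ sumFin b (λ j → sumFin a (λ i → h i j))
sumFin-comm a b h
  rewrite sumFin-cong a (λ i → sumFin≡sum b (h i))
        | sumFin-cong b (λ j → sumFin≡sum a (λ i → h i j))
        | sumFin≡sum a (λ i → sum (h i))
        | sumFin≡sum b (λ j → sum (λ i → h i j)) = ∑-comm h

sumFin-mono-≤ : ∀ k {g h : Fin k → ℕ} → (∀ i → g i ≤ h i) → sumFin k g ≤ sumFin k h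
sumFin-mono-≤ zero    g≤h = z≤n
sumFin-mono-≤ (suc k) g≤h = ℕP.+-mono-≤ (g≤h zero) (sumFin-mono-≤ k (λ i → g≤h (suc i)))

term≤sumFin : ∀ k (g : Fin k → ℕ) i → g i ≤ sumFin k g
term≤sumFin (suc k) g zero    = ℕP.m≤m+n (g zero) _
term≤sumFin (suc k) g (suc i) = ℕP.≤-trans (term≤sumFin k (λ j → g (suc j)) i) (ℕP.m≤n+m _ (g zero))

≟F-suc : ∀ {k} (x y : Fin k) → ⌊ suc x ≟F suc y ⌋ ≡ ⌊ x ≟F y ⌋
≟F-suc x y with x ≟F y
... | true  because _ = refl
... | false because _ = refl

sumFin-zero : ∀ k → sumFin k (λ _ → 0) ≡ 0
sumFin-zero k = trans (sumFin≡sum k _) (sum-replicate-zero k)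

sumFin-select : ∀ k (w : Fin k → ℕ) x → sumFin k (λ v → ⟦ ⌊ x ≟F v ⌋ ⟧ * w v) ≡ w x
sumFin-select (suc k) w zero    =
  trans (cong₂ _+_ (ℕP.+-identityʳ (w zero)) (sumFin-zero k)) (ℕP.+-identityʳ (w zero))
sumFin-select (suc k) w (suc x) = trans
  (sumFin-cong k (λ v → cong (λ b → ⟦ b ⟧ * w (suc v)) (≟F-suc x v)))
  (sumFin-select k (λ v → w (suc v)) x)

⟦∨⟧ : ∀ a b → ⟦ a ∨ b ⟧ ≡ ⟦ a ⟧ + ⟦ b ∧ not a ⟧
⟦∨⟧ true  true  = refl
⟦∨⟧ true  false = refl
⟦∨⟧ false true  = refl
⟦∨⟧ false false = refl

⟦∨-∧⟧ : ∀ a b c → ⟦ (a ∨ b) ∧ c ⟧ ≡ ⟦ a ∧ c ⟧ + ⟦ (b ∧ not a) ∧ c ⟧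
⟦∨-∧⟧ true  true  true  = refl
⟦∨-∧⟧ true  true  false = refl
⟦∨-∧⟧ true  false true  = refl
⟦∨-∧⟧ true  false false = refl
⟦∨-∧⟧ false true  true  = refl
⟦∨-∧⟧ false true  false = refl
⟦∨-∧⟧ false false true  = refl
⟦∨-∧⟧ false false false = refl

⟦∧⟧-monoˡ : ∀ {a b} c → (a ≡ true → b ≡ true) → ⟦ a ∧ c ⟧ ≤ ⟦ b ∧ c ⟧
⟦∧⟧-monoˡ {false} c _   = z≤n
⟦∧⟧-monoˡ {true}  c a⇒b rewrite a⇒b refl = ℕP.≤-refl

⟦∧⟧-* : ∀ a b → ⟦ a ∧ b ⟧ ≡ ⟦ a ⟧ * ⟦ b ⟧
⟦∧⟧-* true  b = sym (ℕP.+-identityʳ ⟦ b ⟧)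
⟦∧⟧-* false b = refl

count-∨ : ∀ k (p q : Fin k → Bool) →
  count k (λ i → p i ∨ q i) ≡ count k p + count k (λ i → q i ∧ not (p i))
count-∨ k p q = trans (sumFin-cong k (λ i → ⟦∨⟧ (p i) (q i))) (sumFin-+ k _ _)

EdgeSet : FactorGraph → Set
EdgeSet G = (f : Fin (m G)) → Fin (arity G f) → Bool

module _ {G : FactorGraph} where

  degreeIn : EdgeSet G → Fin (n G) → ℕ
  degreeIn E v = sumFin (m G) (λ f → count (arity G f) (λ i → E f i ∧ ⌊ nb G f i ≟F v ⌋))

  degreeIn-mono : ∀ {E F : EdgeSet G} → (∀ f i → E f i ≡ true → F f i ≡ true) →
    ∀ v → degreeIn E v ≤ degreeIn F v
  degreeIn-mono E⊆F v =
    sumFin-mono-≤ (m G) (λ f → sumFin-mono-≤ (arity G f) (λ i → ⟦∧⟧-monoˡ _ (E⊆F f i)))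

  degreeIn-∪ : ∀ (E F : EdgeSet G) v → degreeIn (λ f i → E f i ∨ F f i) v
    ≡ degreeIn E v + degreeIn (λ f i → F f i ∧ not (E f i)) v
  degreeIn-∪ E F v = trans
    (sumFin-cong (m G) (λ f → trans
      (sumFin-cong (arity G f) (λ i → ⟦∨-∧⟧ (E f i) (F f i) _))
      (sumFin-+ (arity G f) _ _)))
    (sumFin-+ (m G) _ _)

  sum-weighted-degreeIn : ∀ (E : EdgeSet G) (w : Fin (n G) → ℕ) →
    sumFin (n G) (λ v → w v * degreeIn E v)
      ≡ sumFin (m G) (λ f → sumFin (arity G f) (λ i → ⟦ E f i ⟧ * w (nb G f i)))
  sum-weighted-degreeIn E w = begin
    sumFin (n G) (λ v → w v * degreeIn E v)
      ≡⟨ sumFin-cong (n G) (λ v → trans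
           (sym (sumFin-*ˡ (m G) (w v) _))
           (sumFin-cong (m G) (λ f → sym (sumFin-*ˡ (arity G f) (w v) _)))) ⟩
    sumFin (n G) (λ v → sumFin (m G) (λ f → sumFin (arity G f) (λ i → w v * ⟦ E f i ∧ ⌊ nb G f i ≟F v ⌋ ⟧)))
      ≡⟨ sumFin-comm (n G) (m G) _ ⟩
    sumFin (m G) (λ f → sumFin (n G) (λ v → sumFin (arity G f) (λ i → w v * ⟦ E f i ∧ ⌊ nb G f i ≟F v ⌋ ⟧)))
      ≡⟨ sumFin-cong (m G) (λ f → sumFin-comm (n G) (arity G f) _) ⟩
    sumFin (m G) (λ f → sumFin (arity G f) (λ i → sumFin (n G) (λ v → w v * ⟦ E f i ∧ ⌊ nb G f i ≟F v ⌋ ⟧)))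
      ≡⟨ sumFin-cong (m G) (λ f → sumFin-cong (arity G f) (λ i → pick-endpoint (E f i) (nb G f i))) ⟩
    sumFin (m G) (λ f → sumFin (arity G f) (λ i → ⟦ E f i ⟧ * w (nb G f i))) ∎
    where
    open ≡-Reasoning
    pick-endpoint : ∀ e u → sumFin (n G) (λ v → w v * ⟦ e ∧ ⌊ u ≟F v ⌋ ⟧) ≡ ⟦ e ⟧ * w u
    pick-endpoint e u = begin
      sumFin (n G) (λ v → w v * ⟦ e ∧ ⌊ u ≟F v ⌋ ⟧)
        ≡⟨ sumFin-cong (n G) (λ v → trans (cong (w v *_) (⟦∧⟧-* e _)) (rearrange (w v) ⟦ e ⟧ _)) ⟩
      sumFin (n G) (λ v → ⟦ e ⟧ * (⟦ ⌊ u ≟F v ⌋ ⟧ * w v))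
        ≡⟨ sumFin-*ˡ (n G) ⟦ e ⟧ _ ⟩
      ⟦ e ⟧ * sumFin (n G) (λ v → ⟦ ⌊ u ≟F v ⌋ ⟧ * w v)
        ≡⟨ cong (⟦ e ⟧ *_) (sumFin-select (n G) w u) ⟩
      ⟦ e ⟧ * w u ∎
      where
      rearrange : ∀ x y z → x * (y * z) ≡ y * (z * x)
      rearrange = solve-∀

isPos-mono : ∀ {a b} → a ≤ b → isPos a ≡ true → isPos b ≡ true
isPos-mono {suc a} {suc b} _ _ = refl

isPos≡false : ∀ {d} → isPos d ≡ false → d ≡ 0
isPos≡false {zero} _ = refl

absent⇒degV≡0 : ∀ {G} (X : Subgraph G) v → inV X v ≡ false → degV X v ≡ 0
absent⇒degV≡0 X v absent = isPos≡false (BP.∨-conicalʳ (extra X v) _ absent)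

vertexCredit : Bool → ℕ → ℕ
vertexCredit present d = ⟦ isOne d ⟧ + 2 * ⟦ present ∧ not (isPos d) ⟧

credits≡sum-vertexCredit : ∀ {G} (X : Subgraph G) →
  credits X ≡ sumFin (n G) (λ v → vertexCredit (inV X v) (degV X v))
credits≡sum-vertexCredit {G} X = sym (trans
  (sumFin-+ (n G) (λ v → ⟦ isLeaf X v ⟧) (λ v → 2 * ⟦ isIsolated X v ⟧))
  (cong (count (n G) (isLeaf X) +_) (sumFin-*ˡ (n G) 2 (λ v → ⟦ isIsolated X v ⟧))))

vertexCredit-grow : ∀ a k → vertexCredit true (a + k) + (a ∸ 2) + k ≡ vertexCredit true a + (a + k ∸ 2)
vertexCredit-grow zero          zero          = refl
vertexCredit-grow zero          (suc zero)    = refl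
vertexCredit-grow zero          (suc (suc k)) = refl
vertexCredit-grow (suc zero)    zero          = refl
vertexCredit-grow (suc zero)    (suc k)       = refl
vertexCredit-grow (suc (suc a)) k             = refl

vertexCredit-fresh : ∀ k → vertexCredit (isPos k) k ≤ (k ∸ 2) + ⟦ isOne k ⟧
vertexCredit-fresh zero          = z≤n
vertexCredit-fresh (suc zero)    = ℕP.≤-refl
vertexCredit-fresh (suc (suc k)) = z≤n

edge⇒inC : ∀ {G} (X : Subgraph G) f i → edge X f i ≡ true → inC X f ≡ true
edge⇒inC {G} X f i e =
  isPos-mono (subst (λ b → ⟦ b ⟧ ≤ degC X f) e (term≤sumFin (arity G f) _ i)) refl

edge⇒inV : ∀ {G} (X : Subgraph G) f i → edge X f i ≡ true → inV X (nb G f i) ≡ true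
edge⇒inV {G} X f i e = trans (cong (extra X u ∨_) (isPos-mono 1≤degV refl)) (BP.∨-zeroʳ _)
  where
  u = nb G f i
  1≤degV : 1 ≤ degV X u
  1≤degV = ℕP.≤-trans
    (subst (λ b → ⟦ b ⟧ ≤ count (arity G f) (λ j → edge X f j ∧ ⌊ nb G f j ≟F u ⌋))
           (cong₂ _∧_ e (trans (isYes≗does (u ≟F u)) (dec-true (u ≟F u) refl)))
           (term≤sumFin (arity G f) _ i))
    (term≤sumFin (m G) (λ g → count (arity G g) (λ j → edge X g j ∧ ⌊ nb G g j ≟F u ⌋)) f)

-- For one edge: e, e′ say whether it lies in H, H′; c, x whether its constraint, variable is in H.
boundary-edge≤ : ∀ e e' c x → (e ≡ true → c ≡ true × x ≡ true) →
  ⟦ e' ∧ (c xor x) ⟧ ≤ ⟦ e' ∧ not e ⟧ * (⟦ x ⟧ + ⟦ c ⟧)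
boundary-edge≤ true  e'    c     x     endpoints with endpoints refl
... | refl , refl rewrite BP.∧-zeroʳ e' = z≤n
boundary-edge≤ false false c     x     _ = z≤n
boundary-edge≤ false true  true  true  _ = z≤n
boundary-edge≤ false true  true  false _ = ℕP.≤-refl
boundary-edge≤ false true  false true  _ = ℕP.≤-refl
boundary-edge≤ false true  false false _ = z≤n

constraintDebit-grow : ∀ τ a k → (1 ≤ a → τ ≤ a) → (a ∸ τ) + ⟦ isPos a ⟧ * k ≤ (a + k) ∸ τ
constraintDebit-grow τ zero    k _ rewrite ℕP.0∸n≡0 τ = z≤n
constraintDebit-grow τ (suc a) k τ-cond
  rewrite ℕP.*-identityˡ k | ℕP.+-∸-comm k (τ-cond (s≤s z≤n)) = ℕP.≤-refl

module Merge {G : FactorGraph} (H H' : Subgraph G) where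

  newEdges : EdgeSet G
  newEdges f i = edge H' f i ∧ not (edge H f i)

  newDegV : Fin (n G) → ℕ
  newDegV = degreeIn {G = G} newEdges

  newDegC : Fin (m G) → ℕ
  newDegC f = count (arity G f) (newEdges f)

  degV-∪ : ∀ v → degV (H ∪ H') v ≡ degV H v + newDegV v
  degV-∪ = degreeIn-∪ {G = G} (edge H) (edge H')

  degC-∪ : ∀ f → degC (H ∪ H') f ≡ degC H f + newDegC f
  degC-∪ f = count-∨ (arity G f) (edge H f) (edge H' f)

  newEdges⊆H' : ∀ f i → newEdges f i ≡ true → edge H' f i ≡ true
  newEdges⊆H' f i with edge H' f i
  ... | true  = λ _ → refl
  ... | false = λ ()

  H⊆H∪H' : ∀ f i → edge H f i ≡ true → edge H f i ∨ edge H' f i ≡ true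
  H⊆H∪H' f i e = cong (_∨ edge H' f i) e

  H'⊆H∪H' : ∀ f i → edge H' f i ≡ true → edge H f i ∨ edge H' f i ≡ true
  H'⊆H∪H' f i e = trans (cong (edge H f i ∨_) e) (BP.∨-zeroʳ _)

  inV-∪ˡ : ∀ v → inV H v ≡ true → inV (H ∪ H') v ≡ true
  inV-∪ˡ v inH with extra H v
  ... | true  = refl
  ... | false = trans (cong (extra H' v ∨_) (isPos-mono (degreeIn-mono H⊆H∪H' v) inH)) (BP.∨-zeroʳ _)

  degV-∪-fresh : ∀ v → degV H v ≡ 0 → degV (H ∪ H') v ≡ degV H' v
  degV-∪-fresh v dH≡0 = ℕP.≤-antisym
    (ℕP.≤-trans (ℕP.≤-reflexive (trans (degV-∪ v) (cong (_+ newDegV v) dH≡0)))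
                (degreeIn-mono newEdges⊆H' v))
    (degreeIn-mono H'⊆H∪H' v)

  inV-∪-outside : EdgeInduced H' → ∀ v → inV H v ≡ false → inV (H ∪ H') v ≡ isPos (degV (H ∪ H') v)
  inV-∪-outside H'-edgeInduced v outH rewrite BP.∨-conicalˡ (extra H v) _ outH | H'-edgeInduced v = refl

  variable-balance : EdgeInduced H' → ∀ v →
    vertexCredit (inV (H ∪ H') v) (degV (H ∪ H') v) + (degV H v ∸ 2) + ⟦ inV H v ⟧ * newDegV v
      ≤ vertexCredit (inV H v) (degV H v) + (degV (H ∪ H') v ∸ 2) + ⟦ isLeaf H' v ∧ not (inV H v) ⟧
  variable-balance H'-edgeInduced v with inV H v in inH
  ... | true
    rewrite inV-∪ˡ v inH | degV-∪ v | ℕP.*-identityˡ (newDegV v) | BP.∧-zeroʳ (isLeaf H' v) =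
    ℕP.≤-reflexive (trans (vertexCredit-grow (degV H v) (newDegV v)) (sym (ℕP.+-identityʳ _)))
  ... | false
    rewrite inV-∪-outside H'-edgeInduced v inH | absent⇒degV≡0 H v inH
          | degV-∪-fresh v (absent⇒degV≡0 H v inH) | BP.∧-identityʳ (isOne (degV H' v)) =
    ℕP.≤-trans (ℕP.≤-reflexive (trans (ℕP.+-identityʳ _) (ℕP.+-identityʳ _))) (vertexCredit-fresh (degV H' v))

  constraint-balance : ∀ τ → TauCond τ H → ∀ f →
    (degC H f ∸ τ) + ⟦ inC H f ⟧ * newDegC f ≤ degC (H ∪ H') f ∸ τ
  constraint-balance τ τ-cond f rewrite degC-∪ f =
    constraintDebit-grow τ (degC H f) (newDegC f) (τ-cond f)

  boundary≤ : boundaryCount H H'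
    ≤ sumFin (n G) (λ v → ⟦ inV H v ⟧ * newDegV v) + sumFin (m G) (λ f → ⟦ inC H f ⟧ * newDegC f)
  boundary≤ = begin
    boundaryCount H H'
      ≤⟨ sumFin-mono-≤ (m G) (λ f → sumFin-mono-≤ (arity G f) (λ i →
           boundary-edge≤ (edge H f i) (edge H' f i) (inC H f) (inV H (nb G f i))
             (λ e → edge⇒inC H f i e , edge⇒inV H f i e))) ⟩
    sumFin (m G) (λ f → sumFin (arity G f) (λ i → ⟦ newEdges f i ⟧ * (⟦ inV H (nb G f i) ⟧ + ⟦ inC H f ⟧)))
      ≡⟨ sumFin-cong (m G) (λ f → trans
           (sumFin-cong (arity G f) (λ i → ℕP.*-distribˡ-+ ⟦ newEdges f i ⟧ _ _))
           (sumFin-+ (arity G f) _ _)) ⟩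
    sumFin (m G) (λ f → sumFin (arity G f) (λ i → ⟦ newEdges f i ⟧ * ⟦ inV H (nb G f i) ⟧)
                      + sumFin (arity G f) (λ i → ⟦ newEdges f i ⟧ * ⟦ inC H f ⟧))
      ≡⟨ sumFin-+ (m G) _ _ ⟩
    sumFin (m G) (λ f → sumFin (arity G f) (λ i → ⟦ newEdges f i ⟧ * ⟦ inV H (nb G f i) ⟧))
      + sumFin (m G) (λ f → sumFin (arity G f) (λ i → ⟦ newEdges f i ⟧ * ⟦ inC H f ⟧))
      ≡⟨ cong₂ _+_ (sym (sum-weighted-degreeIn newEdges (λ v → ⟦ inV H v ⟧)))
                   (sumFin-cong (m G) (λ f → trans
                      (sumFin-cong (arity G f) (λ i → ℕP.*-comm ⟦ newEdges f i ⟧ ⟦ inC H f ⟧))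
                      (sumFin-*ˡ (arity G f) ⟦ inC H f ⟧ _))) ⟩
    sumFin (n G) (λ v → ⟦ inV H v ⟧ * newDegV v) + sumFin (m G) (λ f → ⟦ inC H f ⟧ * newDegC f) ∎
    where open ℕP.≤-Reasoning

  variables-balance : EdgeInduced H' →
    credits (H ∪ H') + sumFin (n G) (λ v → degV H v ∸ 2) + sumFin (n G) (λ v → ⟦ inV H v ⟧ * newDegV v)
      ≤ credits H + sumFin (n G) (λ v → degV (H ∪ H') v ∸ 2) + leavesOutside H' H
  variables-balance H'-edgeInduced
    rewrite credits≡sum-vertexCredit (H ∪ H') | credits≡sum-vertexCredit H
          | sym (sumFin-+₃ (n G) (λ v → vertexCredit (inV (H ∪ H') v) (degV (H ∪ H') v))
                                 (λ v → degV H v ∸ 2) (λ v → ⟦ inV H v ⟧ * newDegV v))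
          | sym (sumFin-+₃ (n G) (λ v → vertexCredit (inV H v) (degV H v))
                                 (λ v → degV (H ∪ H') v ∸ 2) (λ v → ⟦ isLeaf H' v ∧ not (inV H v) ⟧)) =
    sumFin-mono-≤ (n G) (variable-balance H'-edgeInduced)

  constraints-balance : ∀ τ → TauCond τ H →
    sumFin (m G) (λ f → degC H f ∸ τ) + sumFin (m G) (λ f → ⟦ inC H f ⟧ * newDegC f)
      ≤ sumFin (m G) (λ f → degC (H ∪ H') f ∸ τ)
  constraints-balance τ τ-cond = ℕP.≤-trans
    (ℕP.≤-reflexive (sym (sumFin-+ (m G) _ _)))
    (sumFin-mono-≤ (m G) (constraint-balance τ τ-cond))

  revenue-balance : ∀ τ → TauCond τ H → EdgeInduced H' →
    credits (H ∪ H') + debits τ H + boundaryCount H H' ≤ credits H + debits τ (H ∪ H') + leavesOutside H' H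
  revenue-balance τ τ-cond H'-edgeInduced =
    combine {cU = credits (H ∪ H')} {cH = credits H}
            {x = sumFin (n G) (λ v → ⟦ inV H v ⟧ * newDegV v)}
            {y = sumFin (m G) (λ f → ⟦ inC H f ⟧ * newDegC f)}
            (variables-balance H'-edgeInduced) (constraints-balance τ τ-cond) boundary≤
    where
    combine : ∀ {cU cH vH vU fH fU x y l b} →
      cU + vH + x ≤ cH + vU + l → fH + y ≤ fU → b ≤ x + y →
      cU + (vH + fH) + b ≤ cH + (vU + fU) + l
    combine {cU} {cH} {vH} {vU} {fH} {fU} {x} {y} {l} {b} vars cons bd = begin
      cU + (vH + fH) + b             ≤⟨ ℕP.+-monoʳ-≤ (cU + (vH + fH)) bd ⟩
      cU + (vH + fH) + (x + y)       ≡⟨ regroupˡ cU vH fH x y ⟩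
      (cU + vH + x) + (fH + y)       ≤⟨ ℕP.+-mono-≤ vars cons ⟩
      (cH + vU + l) + fU             ≡⟨ regroupʳ cH vU l fU ⟩
      cH + (vU + fU) + l             ∎
      where
      open ℕP.≤-Reasoning
      regroupˡ : ∀ a b c d e → a + (b + c) + (d + e) ≡ (a + b + d) + (c + e)
      regroupˡ = solve-∀
      regroupʳ : ∀ a b c d → (a + b + c) + d ≡ a + (b + d) + c
      regroupʳ = solve-∀

ℤ→ℚ≡mkℚ : ∀ z → ℤ→ℚ z ≡ mkℚ z 0 (Coprime.sym (Coprime.1-coprimeTo ℤ.∣ z ∣))
ℤ→ℚ≡mkℚ z = ℚP.↥p/↧p≡p (mkℚ z 0 (Coprime.sym (Coprime.1-coprimeTo ℤ.∣ z ∣)))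

ℤ→ℚ-+ : ∀ x y → ℤ→ℚ (x ℤ.+ y) ≡ ℤ→ℚ x ℚ.+ ℤ→ℚ y
ℤ→ℚ-+ x y rewrite ℤ→ℚ≡mkℚ x | ℤ→ℚ≡mkℚ y | ℤP.*-identityʳ x | ℤP.*-identityʳ y = refl

ℤ→ℚ-mono-≤ : ∀ {x y} → x ℤ.≤ y → ℤ→ℚ x ℚ.≤ ℤ→ℚ y
ℤ→ℚ-mono-≤ {x} {y} x≤y rewrite ℤ→ℚ≡mkℚ x | ℤ→ℚ≡mkℚ y =
  ℚ.*≤* (subst₂ ℤ._≤_ (sym (ℤP.*-identityʳ x)) (sym (ℤP.*-identityʳ y)) x≤y)

ℕ-balance⇒ℤ : ∀ a e c d b l → a + d + b ≤ c + e + l →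
  (ℤ.+ a ℤ.- ℤ.+ e) ℤ.+ ℤ.+ b ℤ.≤ (ℤ.+ c ℤ.- ℤ.+ d) ℤ.+ ℤ.+ l
ℕ-balance⇒ℤ a e c d b l h = begin
  (ℤ.+ a ℤ.- ℤ.+ e) ℤ.+ ℤ.+ b      ≡⟨ recentre a d e b ⟩
  ℤ.+ (a + d + b) ℤ.- ℤ.+ (d + e)  ≤⟨ ℤP.+-monoˡ-≤ (ℤ.- ℤ.+ (d + e)) (ℤ.+≤+ h) ⟩
  ℤ.+ (c + e + l) ℤ.- ℤ.+ (d + e)  ≡⟨ cong (λ t → ℤ.+ (c + e + l) ℤ.- ℤ.+ t) (ℕP.+-comm d e) ⟩
  ℤ.+ (c + e + l) ℤ.- ℤ.+ (e + d)  ≡⟨ recentre c e d l ⟨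
  (ℤ.+ c ℤ.- ℤ.+ d) ℤ.+ ℤ.+ l      ∎
  where
  open ℤP.≤-Reasoning
  shift : ∀ A D E B → (A ℤ.- E) ℤ.+ B ≡ (A ℤ.+ D ℤ.+ B) ℤ.- (D ℤ.+ E)
  shift = ℤSolver.solve-∀
  recentre : ∀ a d e b → (ℤ.+ a ℤ.- ℤ.+ e) ℤ.+ ℤ.+ b ≡ ℤ.+ (a + d + b) ℤ.- ℤ.+ (d + e)
  recentre a d e b rewrite ℤP.pos-+ (a + d) b | ℤP.pos-+ a d | ℤP.pos-+ d e =
    shift (ℤ.+ a) (ℤ.+ d) (ℤ.+ e) (ℤ.+ b)

revenue-∪≤ : ∀ τ {G} (H H' : Subgraph G) → TauCond τ H → EdgeInduced H' →
  Revenue τ (H ∪ H') ℤ.+ ℤ.+ boundaryCount H H' ℤ.≤ Revenue τ H ℤ.+ ℤ.+ leavesOutside H' H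
revenue-∪≤ τ H H' H-τ H'-edgeInduced =
  ℕ-balance⇒ℤ (credits (H ∪ H')) (debits τ (H ∪ H')) (credits H) (debits τ H) _ _
              (Merge.revenue-balance H H' τ H-τ H'-edgeInduced)

ℤ-balance⇒ℚ : ∀ {x y b l r s} → x ℤ.+ ℤ.+ b ℤ.≤ y ℤ.+ ℤ.+ l → ℤ→ℚ y ℚ.≤ r → ℕ→ℚ l ℚ.≤ s →
  ℤ→ℚ x ℚ.≤ r ℚ.+ s ℚ.- ℕ→ℚ b
ℤ-balance⇒ℚ {x} {y} {b} {l} {r} {s} x+b≤y+l y≤r l≤s = begin
  ℤ→ℚ x                           ≡⟨ ℚGroup.//-rightDividesʳ (ℕ→ℚ b) (ℤ→ℚ x) ⟨
  ℤ→ℚ x ℚ.+ ℕ→ℚ b ℚ.- ℕ→ℚ b        ≡⟨ cong (ℚ._- ℕ→ℚ b) (ℤ→ℚ-+ x (ℤ.+ b)) ⟨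
  ℤ→ℚ (x ℤ.+ ℤ.+ b) ℚ.- ℕ→ℚ b      ≤⟨ ℚP.+-monoˡ-≤ (ℚ.- ℕ→ℚ b) (ℤ→ℚ-mono-≤ x+b≤y+l) ⟩
  ℤ→ℚ (y ℤ.+ ℤ.+ l) ℚ.- ℕ→ℚ b      ≡⟨ cong (ℚ._- ℕ→ℚ b) (ℤ→ℚ-+ y (ℤ.+ l)) ⟩
  ℤ→ℚ y ℚ.+ ℕ→ℚ l ℚ.- ℕ→ℚ b        ≤⟨ ℚP.+-monoˡ-≤ (ℚ.- ℕ→ℚ b) (ℚP.+-mono-≤ y≤r l≤s) ⟩
  r ℚ.+ s ℚ.- ℕ→ℚ b               ∎
  where open ℚP.≤-Reasoning

lemma6p14 : (τ K SMALL : ℕ) (ζ : ℚ) (G : FactorGraph) →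
  3 ≤ τ → τ ≤ K →
  (∀ (f : Fin (m G)) → τ ∸ 1 ≤ arity G f) →
  (∀ (f : Fin (m G)) → arity G f ≤ K) →
  1 ≤ SMALL → 2 ℕ.* SMALL ≤ n G →
  ℚ.0ℚ ℚ.< ζ → ζ ℚ.< ℚ.1ℚ →
  ℕ→ℚ K ℚ.≤ ζ ℚ.* ℕ→ℚ SMALL →
  PlausibilityAssumption τ SMALL ζ G →
  (H H' : Subgraph G) (r s : ℚ) (b : ℕ) →
  IsTauSubgraph⁺ τ H → Small SMALL H → ℤ→ℚ (Revenue τ H) ℚ.≤ r →
  IsTauSubgraph τ H' → Small SMALL H' → ℕ→ℚ (leavesOutside H' H) ℚ.≤ s →
  r ℚ.+ s ℚ.≤ ζ ℚ.* ℕ→ℚ SMALL →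
  boundaryCount H H' ≡ b →
  ℤ→ℚ (Revenue τ (H ∪ H')) ℚ.≤ r ℚ.+ s ℚ.- ℕ→ℚ b
lemma6p14 τ _ _ _ _ _ _ _ _ _ _ _ _ _ _ H H' _ _ _
          H-τ _ R[H]≤r (H'-edgeInduced , _) _ leaves≤s _ refl =
  ℤ-balance⇒ℚ {x = Revenue τ (H ∪ H')} {y = Revenue τ H}
    (revenue-∪≤ τ H H' H-τ H'-edgeInduced) R[H]≤r leaves≤s
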